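{- For every positive integer $n$, $$\sum_{k=0}^{n-1}(3k+2)(-1)^k f_k \equiv \begin{cases} 2n^2, & \text{if $n$ is a power of $2$},\\ 0, & \text{otherwise},\end{cases} \pmod{4n^2},$$ where $f_k=\sum_{j=0}^{k}\binom{k}{j}^3$ is the $k$-th Franel number.
   Context: The Franel numbers are defined for all nonnegative integers $k$ by $f_k=\sum_{j=0}^{k}\binom{k}{j}^3$. Here "power of $2$" includes $2^0=1$. -}

module Defs where

open import Data.Nat using (ℕ; zero; suc; _+_; _*_; _^_)
open import Data.Nat.Combinatorics using (_C_)
open import Data.Integer as ℤ using (ℤ; +_; -_)
open import Data.Product using (∃-syntax; _×_)
open import Relation.Binary.PropositionalEquality using (_≡_)

sumTo : ℕ → (ℕ → ℕ) → ℕ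
sumTo zero    g = 0
sumTo (suc m) g = sumTo m g + g m

franel : ℕ → ℕ
franel k = sumTo (suc k) (λ j → (k C j) ^ 3)

sign : ℕ → ℤ
sign zero    = + 1
sign (suc k) = - sign k

franelSum : ℕ → ℤ
franelSum zero    = + 0
franelSum (suc n) = franelSum n ℤ.+ (+ (3 * n + 2)) ℤ.* sign n ℤ.* (+ franel n)

IsPowerOf2 : ℕ → Set
IsPowerOf2 n = ∃[ a ] n ≡ 2 ^ a

-- Write M(k,j) = C(k,j) C(j,k-j), c_j = C(2j,j), Cat_j = c_j/(j+1) and T_m = Σ_j M(m,j) Cat_j.
--  1. Binomial identities (factorial formula, absorption, subset-of-subset) and Vandermonde's
--     convolution give Strehl's identity  f_n = Σ_j M(n,j) c_j.
--  2. A telescoping certificate G_m(j) = (2j-m-1) M(m+1,j) c_j, verified termwise from the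
--     neighbour relations of M, c and Cat, proves the recurrence
--       2(m+2)² T_{m+1} + 2(m+1)² T_m = (3m+5) f_{m+1}.
--  3. By induction the sum for n = m+1 equals (-1)^m 2n² T_m.
--  4. Modulo 2, M(m,j) is even for j < m, so T_m ≡ Cat_m ≡ C(2m+1,m+1); by Lucas' theorem
--     for the last binary digit this is odd exactly when m+1 is a power of 2.
-- Hence the sum is 2n²·odd or 2n²·even, which is the statement.

module Submission where

open import Defs
open import Data.Nat using (ℕ; _*_; _>_)
open import Data.Integer as ℤ using (ℤ; +_)
open import Data.Integer.Divisibility using (_∣_)
open import Relation.Nullary using (¬_)
open import Data.Product using (_×_)

open import Data.Nat
open import Data.Nat.Properties
open import Data.Nat.Combinatorics
  using (_C_; nCk≡n!/k![n-k]!; k![n∸k]!∣n!; k>n⇒nCk≡0; nCk≡nC[n∸k]; nCn≡1; nC1≡n; nCk+nC[k+1]≡[n+1]C[k+1])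
open import Data.Nat.DivMod using (_%_; _/_; m/n*n≡m; %-distribˡ-+; %-distribˡ-*; m*n%n≡0; m≡m%n+[m/n]*n)
open import Data.Nat.Induction using (<-rec)
open import Data.Nat.Tactic.RingSolver using (solve-∀)
open import Data.Integer using (-_)
import Data.Integer.Properties as ℤ
open import Data.Integer.Divisibility.Signed as Signed using (∣⇒∣ᵤ)
import Data.Integer.Tactic.RingSolver as ℤ-Solver
open import Data.Sum using (_⊎_; inj₁; inj₂)
open import Data.Product using (_,_; ∃)
open import Function using (_∘_)
open import Relation.Nullary using (yes; no; contradiction)
open import Relation.Binary.PropositionalEquality
open ≡-Reasoning

cancel-by : ∀ {x y z} d .{{_ : NonZero d}} → x * d ≡ z → y * d ≡ z → x ≡ y
cancel-by {x} {y} d xd yd = *-cancelʳ-≡ x y d (trans xd (sym yd))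

C-factorial : ∀ {n k} → k ≤ n → (n C k) * (k ! * (n ∸ k) !) ≡ n !
C-factorial {n} {k} k≤n = begin
  (n C k) * (k ! * (n ∸ k) !)                  ≡⟨ cong (_* (k ! * (n ∸ k) !)) (nCk≡n!/k![n-k]! k≤n) ⟩
  n ! / (k ! * (n ∸ k) !) * (k ! * (n ∸ k) !)  ≡⟨ m/n*n≡m (k![n∸k]!∣n! k≤n) ⟩
  n !                                          ∎
  where instance _ = k !* (n ∸ k) !≢0

C-factorial+ : ∀ a b → ((a + b) C a) * (a ! * b !) ≡ (a + b) !
C-factorial+ a b = subst (λ r → ((a + b) C a) * (a ! * r !) ≡ (a + b) !)
                         (m+n∸m≡n a b) (C-factorial (m≤m+n a b))

C-sym+ : ∀ a b → ((a + b) C a) ≡ ((a + b) C b)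
C-sym+ a b = trans (nCk≡nC[n∸k] (m≤m+n a b)) (cong ((a + b) C_) (m+n∸m≡n a b))

C-absorb : ∀ n k → suc k * (suc n C suc k) ≡ suc n * (n C k)
C-absorb n k with k ≤? n
... | no k≰n = begin
  suc k * (suc n C suc k)  ≡⟨ cong (suc k *_) (k>n⇒nCk≡0 (s<s (≰⇒> k≰n))) ⟩
  suc k * 0                ≡⟨ *-zeroʳ (suc k) ⟩
  0                        ≡⟨ *-zeroʳ (suc n) ⟨
  suc n * 0                ≡⟨ cong (suc n *_) (k>n⇒nCk≡0 (≰⇒> k≰n)) ⟨
  suc n * (n C k)          ∎
... | yes k≤n = cancel-by (k ! * (n ∸ k) !) {{k !* (n ∸ k) !≢0}} lhs rhs
  where
  reassoc : ∀ a c f g → a * c * (f * g) ≡ c * (a * f * g)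
  reassoc = solve-∀
  lhs : suc k * (suc n C suc k) * (k ! * (n ∸ k) !) ≡ suc n !
  lhs = trans (reassoc (suc k) (suc n C suc k) (k !) ((n ∸ k) !)) (C-factorial (s≤s k≤n))
  rhs : suc n * (n C k) * (k ! * (n ∸ k) !) ≡ suc n !
  rhs = trans (*-assoc (suc n) (n C k) _) (cong (suc n *_) (C-factorial k≤n))

∸-∸-cancel : ∀ a {b c} → c ≤ b → a ∸ c ∸ (b ∸ c) ≡ a ∸ b
∸-∸-cancel a {b} {c} c≤b = trans (∸-+-assoc a c (b ∸ c)) (cong (a ∸_) (m+[n∸m]≡n c≤b))

-- Choosing a c-subset of a b-subset of an a-set, counted two ways:
--   C(a,b) C(b,c) = C(a,c) C(a-c,b-c)   for c ≤ b.
C-subset : ∀ a b c → c ≤ b → (a C b) * (b C c) ≡ (a C c) * ((a ∸ c) C (b ∸ c))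
C-subset a b c c≤b with b ≤? a
... | yes b≤a = cancel-by (c ! * (b ∸ c) ! * (a ∸ b) !) {{D≢0}} lhs rhs
  where
  D≢0 = m*n≢0 _ _ {{c !* (b ∸ c) !≢0}} {{(a ∸ b) !≢0}}
  reassocˡ : ∀ x y f g h → x * y * (f * g * h) ≡ x * (y * (f * g) * h)
  reassocˡ = solve-∀
  reassocʳ : ∀ x y f g h → x * y * (f * g * h) ≡ x * (f * (y * (g * h)))
  reassocʳ = solve-∀
  lhs : (a C b) * (b C c) * (c ! * (b ∸ c) ! * (a ∸ b) !) ≡ a !
  lhs = begin
    (a C b) * (b C c) * (c ! * (b ∸ c) ! * (a ∸ b) !)    ≡⟨ reassocˡ (a C b) (b C c) (c !) ((b ∸ c) !) ((a ∸ b) !) ⟩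
    (a C b) * ((b C c) * (c ! * (b ∸ c) !) * (a ∸ b) !)  ≡⟨ cong (λ t → (a C b) * (t * (a ∸ b) !)) (C-factorial c≤b) ⟩
    (a C b) * (b ! * (a ∸ b) !)                          ≡⟨ C-factorial b≤a ⟩
    a !                                                  ∎
  rhs : (a C c) * ((a ∸ c) C (b ∸ c)) * (c ! * (b ∸ c) ! * (a ∸ b) !) ≡ a !
  rhs = begin
    (a C c) * ((a ∸ c) C (b ∸ c)) * (c ! * (b ∸ c) ! * (a ∸ b) !)
      ≡⟨ reassocʳ (a C c) ((a ∸ c) C (b ∸ c)) (c !) ((b ∸ c) !) ((a ∸ b) !) ⟩
    (a C c) * (c ! * (((a ∸ c) C (b ∸ c)) * ((b ∸ c) ! * (a ∸ b) !)))
      ≡⟨ cong (λ t → (a C c) * (c ! * (((a ∸ c) C (b ∸ c)) * ((b ∸ c) ! * t !)))) (sym (∸-∸-cancel a c≤b)) ⟩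
    (a C c) * (c ! * (((a ∸ c) C (b ∸ c)) * ((b ∸ c) ! * (a ∸ c ∸ (b ∸ c)) !)))
      ≡⟨ cong (λ t → (a C c) * (c ! * t)) (C-factorial (∸-monoˡ-≤ c b≤a)) ⟩
    (a C c) * (c ! * (a ∸ c) !)
      ≡⟨ C-factorial (≤-trans c≤b b≤a) ⟩
    a ! ∎
... | no b≰a with c ≤? a
...   | yes c≤a = begin
  (a C b) * (b C c)                ≡⟨ cong (_* (b C c)) (k>n⇒nCk≡0 (≰⇒> b≰a)) ⟩
  0                                ≡⟨ *-zeroʳ (a C c) ⟨
  (a C c) * 0                      ≡⟨ cong ((a C c) *_) (k>n⇒nCk≡0 (∸-monoˡ-< (≰⇒> b≰a) c≤a)) ⟨
  (a C c) * ((a ∸ c) C (b ∸ c))    ∎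
...   | no c≰a = begin
  (a C b) * (b C c)                ≡⟨ cong (_* (b C c)) (k>n⇒nCk≡0 (≰⇒> b≰a)) ⟩
  0                                ≡⟨ cong (_* ((a ∸ c) C (b ∸ c))) (k>n⇒nCk≡0 (≰⇒> c≰a)) ⟨
  (a C c) * ((a ∸ c) C (b ∸ c))    ∎

C-subset-complement : ∀ n j i → i ≤ n → j ≤ n → (n C j) * (j C i) ≡ (n C i) * ((n ∸ i) C (n ∸ j))
C-subset-complement n j i i≤n j≤n with i ≤? j
... | yes i≤j = begin
  (n C j) * (j C i)                  ≡⟨ C-subset n j i i≤j ⟩
  (n C i) * ((n ∸ i) C (j ∸ i))      ≡⟨ cong ((n C i) *_) (nCk≡nC[n∸k] (∸-monoˡ-≤ i j≤n)) ⟩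
  (n C i) * ((n ∸ i) C (n ∸ i ∸ (j ∸ i)))  ≡⟨ cong (λ k → (n C i) * ((n ∸ i) C k)) (∸-∸-cancel n i≤j) ⟩
  (n C i) * ((n ∸ i) C (n ∸ j))      ∎
... | no i≰j = begin
  (n C j) * (j C i)                  ≡⟨ cong ((n C j) *_) (k>n⇒nCk≡0 (≰⇒> i≰j)) ⟩
  (n C j) * 0                        ≡⟨ *-zeroʳ (n C j) ⟩
  0                                  ≡⟨ *-zeroʳ (n C i) ⟨
  (n C i) * 0                        ≡⟨ cong ((n C i) *_) (k>n⇒nCk≡0 (∸-monoʳ-< (≰⇒> i≰j) i≤n)) ⟨
  (n C i) * ((n ∸ i) C (n ∸ j))      ∎

sum-cong : ∀ n {f g : ℕ → ℕ} → (∀ i → i < n → f i ≡ g i) → sumTo n f ≡ sumTo n g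
sum-cong zero    eq = refl
sum-cong (suc n) eq = cong₂ _+_ (sum-cong n (λ i i<n → eq i (m<n⇒m<1+n i<n))) (eq n (n<1+n n))

sum-+ : ∀ n (f g : ℕ → ℕ) → sumTo n (λ i → f i + g i) ≡ sumTo n f + sumTo n g
sum-+ zero    f g = refl
sum-+ (suc n) f g = trans (cong (_+ (f n + g n)) (sum-+ n f g)) (interchange (sumTo n f) (sumTo n g) (f n) (g n))
  where interchange : ∀ a b c d → a + b + (c + d) ≡ a + c + (b + d)
        interchange = solve-∀

sum-*ˡ : ∀ n c (f : ℕ → ℕ) → sumTo n (λ i → c * f i) ≡ c * sumTo n f
sum-*ˡ zero    c f = sym (*-zeroʳ c)
sum-*ˡ (suc n) c f = trans (cong (_+ c * f n) (sum-*ˡ n c f)) (sym (*-distribˡ-+ c (sumTo n f) (f n)))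

sum-zero : ∀ n (f : ℕ → ℕ) → (∀ i → i < n → f i ≡ 0) → sumTo n f ≡ 0
sum-zero zero    f z = refl
sum-zero (suc n) f z = cong₂ _+_ (sum-zero n f (λ i i<n → z i (m<n⇒m<1+n i<n))) (z n (n<1+n n))

sum-first : ∀ n (f : ℕ → ℕ) → sumTo (suc n) f ≡ f 0 + sumTo n (λ i → f (suc i))
sum-first zero    f = sym (+-identityʳ (f 0))
sum-first (suc n) f = trans (cong (_+ f (suc n)) (sum-first n f)) (+-assoc (f 0) _ _)

sum-extend : ∀ n t (f : ℕ → ℕ) → (∀ i → n ≤ i → f i ≡ 0) → sumTo (t + n) f ≡ sumTo n f
sum-extend n zero    f z = refl
sum-extend n (suc t) f z = begin
  sumTo (t + n) f + f (t + n) ≡⟨ cong₂ _+_ (sum-extend n t f z) (z (t + n) (m≤n+m n t)) ⟩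
  sumTo n f + 0               ≡⟨ +-identityʳ _ ⟩
  sumTo n f                   ∎

sum-swap : ∀ n m (f : ℕ → ℕ → ℕ) →
  sumTo n (λ i → sumTo m (f i)) ≡ sumTo m (λ j → sumTo n (λ i → f i j))
sum-swap zero    m f = sym (sum-zero m _ (λ _ _ → refl))
sum-swap (suc n) m f = trans (cong (_+ sumTo m (f n)) (sum-swap n m f))
                             (sym (sum-+ m (λ j → sumTo n (λ i → f i j)) (f n)))

sum-reverse : ∀ n (g : ℕ → ℕ) → sumTo (suc n) (λ j → g (n ∸ j)) ≡ sumTo (suc n) g
sum-reverse zero    g = refl
sum-reverse (suc n) g = begin
  sumTo (suc n) (λ j → g (suc n ∸ j)) + g (n ∸ n)
    ≡⟨ cong₂ (λ s i → s + g i) (sum-cong (suc n) (λ j j≤n → cong g (+-∸-assoc 1 (≤-pred j≤n)))) (n∸n≡0 n) ⟩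
  sumTo (suc n) (λ j → g (suc (n ∸ j))) + g 0
    ≡⟨ cong (_+ g 0) (sum-reverse n (λ l → g (suc l))) ⟩
  sumTo (suc n) (λ l → g (suc l)) + g 0
    ≡⟨ +-comm _ (g 0) ⟩
  g 0 + sumTo (suc n) (λ l → g (suc l))
    ≡⟨ sum-first (suc n) g ⟨
  sumTo (suc (suc n)) g ∎

telescope : ∀ N (L R G : ℕ → ℕ) → (∀ j → L j + G j ≡ R j + G (suc j)) →
  sumTo N L + G 0 ≡ sumTo N R + G N
telescope zero    L R G step = refl
telescope (suc N) L R G step = begin
  sumTo N L + L N + G 0      ≡⟨ swap₂₃ (sumTo N L) (L N) (G 0) ⟩
  sumTo N L + G 0 + L N      ≡⟨ cong (_+ L N) (telescope N L R G step) ⟩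
  sumTo N R + G N + L N      ≡⟨ +-assoc (sumTo N R) (G N) (L N) ⟩
  sumTo N R + (G N + L N)    ≡⟨ cong (λ x → sumTo N R + x) (trans (+-comm (G N) (L N)) (step N)) ⟩
  sumTo N R + (R N + G (suc N)) ≡⟨ +-assoc (sumTo N R) (R N) (G (suc N)) ⟨
  sumTo N R + R N + G (suc N) ∎
  where swap₂₃ : ∀ a b c → a + b + c ≡ a + c + b
        swap₂₃ = solve-∀

vandermonde : ∀ a b n → sumTo (suc n) (λ k → (a C k) * (b C (n ∸ k))) ≡ (a + b) C n
vandermonde zero b n = begin
  sumTo (suc n) (λ k → (0 C k) * (b C (n ∸ k)))   ≡⟨ sum-first n _ ⟩
  (b C n) + 0 + sumTo n (λ _ → 0)                 ≡⟨ cong₂ _+_ (+-identityʳ (b C n)) (sum-zero n _ (λ _ _ → refl)) ⟩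
  (b C n) + 0                                     ≡⟨ +-identityʳ (b C n) ⟩
  b C n                                           ∎
vandermonde (suc a) b zero = refl
vandermonde (suc a) b (suc n) = begin
  sumTo (suc (suc n)) (λ k → (suc a C k) * (b C (suc n ∸ k)))
    ≡⟨ sum-first (suc n) _ ⟩
  (b C suc n) + 0 + sumTo (suc n) (λ i → (suc a C suc i) * (b C (n ∸ i)))
    ≡⟨ cong (λ x → (b C suc n) + 0 + x) (trans (sum-cong (suc n) (λ i _ → pascal i)) (sum-+ (suc n) _ _)) ⟩
  (b C suc n) + 0 + (Σ₀ + Σ₁)
    ≡⟨ regroup (b C suc n) Σ₀ Σ₁ ⟩
  Σ₀ + ((a C 0) * (b C suc n) + Σ₁)
    ≡⟨ cong₂ _+_ (vandermonde a b n) (sym (sum-first (suc n) (λ k → (a C k) * (b C (suc n ∸ k))))) ⟩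
  ((a + b) C n) + sumTo (suc (suc n)) (λ k → (a C k) * (b C (suc n ∸ k)))
    ≡⟨ cong (λ x → ((a + b) C n) + x) (vandermonde a b (suc n)) ⟩
  ((a + b) C n) + ((a + b) C suc n)
    ≡⟨ nCk+nC[k+1]≡[n+1]C[k+1] (a + b) n ⟩
  suc (a + b) C suc n ∎
  where
  Σ₀ = sumTo (suc n) (λ i → (a C i) * (b C (n ∸ i)))
  Σ₁ = sumTo (suc n) (λ i → (a C suc i) * (b C (n ∸ i)))
  pascal : ∀ i → (suc a C suc i) * (b C (n ∸ i)) ≡ (a C i) * (b C (n ∸ i)) + (a C suc i) * (b C (n ∸ i))
  pascal i = trans (cong (_* (b C (n ∸ i))) (sym (nCk+nC[k+1]≡[n+1]C[k+1] a i)))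
                   (*-distribʳ-+ (b C (n ∸ i)) (a C i) (a C suc i))
  regroup : ∀ x y z → x + 0 + (y + z) ≡ y + (1 * x + z)
  regroup = solve-∀

-- Σ_{l=0}^{N} C(a,l) C(b,l) = C(a+b,a)  for a ≤ N: Vandermonde after C(a,l) = C(a,a-l),
-- the terms with l > a being zero.
vandermonde-squares : ∀ a b N → a ≤ N → sumTo (suc N) (λ l → (a C l) * (b C l)) ≡ (a + b) C a
vandermonde-squares a b N a≤N with m≤n⇒∃[o]m+o≡n a≤N
... | t , refl = begin
  sumTo (suc (a + t)) (λ l → (a C l) * (b C l))
    ≡⟨ cong (λ k → sumTo k (λ l → (a C l) * (b C l))) (trans (+-suc t a) (cong suc (+-comm t a))) ⟨
  sumTo (t + suc a) (λ l → (a C l) * (b C l))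
    ≡⟨ sum-extend (suc a) t _ (λ l a<l → cong (_* (b C l)) (k>n⇒nCk≡0 a<l)) ⟩
  sumTo (suc a) (λ l → (a C l) * (b C l))
    ≡⟨ sum-cong (suc a) (λ l l≤a → trans (*-comm (a C l) (b C l)) (cong ((b C l) *_) (nCk≡nC[n∸k] (≤-pred l≤a)))) ⟩
  sumTo (suc a) (λ l → (b C l) * (a C (a ∸ l)))
    ≡⟨ vandermonde b a a ⟩
  (b + a) C a
    ≡⟨ cong (_C a) (+-comm b a) ⟩
  (a + b) C a ∎

-- The trinomial coefficient M(k,j) = C(k,j) C(j,k-j) = k! / ((k-j)!² (2j-k)!)
-- and the central binomial coefficient c_j = C(2j,j).
trinom : ℕ → ℕ → ℕ
trinom k j = (k C j) * (j C (k ∸ j))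

central : ℕ → ℕ
central j = (j + j) C j

-- Expanding C(2j,n) by
-- Vandermonde turns Σ_j C(n,j)² C(2j,n) into a double sum which, after
-- exchanging the summations, collapses to Σ_i C(n,i)³ by Vandermonde again.
strehl : ∀ n → franel n ≡ sumTo (suc n) (λ j → trinom n j * central j)
strehl n = sym (begin
  sumTo (suc n) (λ j → trinom n j * central j)
    ≡⟨ sum-cong (suc n) (λ j j≤n → trinom-central j (≤-pred j≤n)) ⟩
  sumTo (suc n) (λ j → (n C j) * (n C j) * ((j + j) C n))
    ≡⟨ sum-cong (suc n) (λ j _ → expand-column j) ⟩
  sumTo (suc n) (λ j → sumTo (suc n) (λ i → term i j))
    ≡⟨ sum-swap (suc n) (suc n) (λ j i → term i j) ⟩
  sumTo (suc n) (λ i → sumTo (suc n) (λ j → term i j))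
    ≡⟨ sum-cong (suc n) (λ i i≤n → collapse-row i (≤-pred i≤n)) ⟩
  sumTo (suc n) (λ i → (n C i) * (n C i) * (n C i))
    ≡⟨ sum-cong (suc n) (λ i _ → cube (n C i)) ⟩
  franel n ∎)
  where
  square-split : ∀ x y z → x * x * (y * z) ≡ (x * y) * (x * z)
  square-split = solve-∀
  cube : ∀ x → x * x * x ≡ x ^ 3
  cube x = trans (*-assoc x x x) (cong (λ t → x * (x * t)) (sym (*-identityʳ x)))
  term : ℕ → ℕ → ℕ
  term i j = ((n C j) * (j C i)) * ((n C j) * (j C (n ∸ i)))
  -- C(n,j) C(j,n-j) C(2j,j) = C(n,j)² C(2j,n), by C-subset for n-subsets of a 2j-set.
  trinom-central : ∀ j → j ≤ n → trinom n j * central j ≡ (n C j) * (n C j) * ((j + j) C n)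
  trinom-central j j≤n = begin
    (n C j) * (j C (n ∸ j)) * ((j + j) C j)
      ≡⟨ rearrange (n C j) (j C (n ∸ j)) ((j + j) C j) ⟩
    (n C j) * (((j + j) C j) * (j C (n ∸ j)))
      ≡⟨ cong (λ k → (n C j) * (((j + j) C j) * (k C (n ∸ j)))) (m+n∸m≡n j j) ⟨
    (n C j) * (((j + j) C j) * ((j + j ∸ j) C (n ∸ j)))
      ≡⟨ cong ((n C j) *_) (C-subset (j + j) n j j≤n) ⟨
    (n C j) * (((j + j) C n) * (n C j))
      ≡⟨ rearrange′ (n C j) ((j + j) C n) ⟩
    (n C j) * (n C j) * ((j + j) C n) ∎
    where rearrange : ∀ x y z → x * y * z ≡ x * (z * y)
          rearrange = solve-∀
          rearrange′ : ∀ x y → x * (y * x) ≡ x * x * y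
          rearrange′ = solve-∀
  expand-column : ∀ j → (n C j) * (n C j) * ((j + j) C n) ≡ sumTo (suc n) (λ i → term i j)
  expand-column j = begin
    (n C j) * (n C j) * ((j + j) C n)
      ≡⟨ cong ((n C j) * (n C j) *_) (vandermonde j j n) ⟨
    (n C j) * (n C j) * sumTo (suc n) (λ i → (j C i) * (j C (n ∸ i)))
      ≡⟨ sum-*ˡ (suc n) ((n C j) * (n C j)) (λ i → (j C i) * (j C (n ∸ i))) ⟨
    sumTo (suc n) (λ i → (n C j) * (n C j) * ((j C i) * (j C (n ∸ i))))
      ≡⟨ sum-cong (suc n) (λ i _ → square-split (n C j) (j C i) (j C (n ∸ i))) ⟩
    sumTo (suc n) (λ i → term i j) ∎
  collapse-row : ∀ i → i ≤ n → sumTo (suc n) (λ j → term i j) ≡ (n C i) * (n C i) * (n C i)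
  collapse-row i i≤n = begin
    sumTo (suc n) (λ j → term i j)
      ≡⟨ sum-cong (suc n) (λ j j≤n → complement-both j (≤-pred j≤n)) ⟩
    sumTo (suc n) (λ j → (n C i) * (n C i) * (((n ∸ i) C (n ∸ j)) * (i C (n ∸ j))))
      ≡⟨ sum-*ˡ (suc n) ((n C i) * (n C i)) (λ j → ((n ∸ i) C (n ∸ j)) * (i C (n ∸ j))) ⟩
    (n C i) * (n C i) * sumTo (suc n) (λ j → ((n ∸ i) C (n ∸ j)) * (i C (n ∸ j)))
      ≡⟨ cong ((n C i) * (n C i) *_) (sum-reverse n (λ l → ((n ∸ i) C l) * (i C l))) ⟩
    (n C i) * (n C i) * sumTo (suc n) (λ l → ((n ∸ i) C l) * (i C l))
      ≡⟨ cong ((n C i) * (n C i) *_) inner-sum ⟩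
    (n C i) * (n C i) * (n C i) ∎
    where
    complement-both : ∀ j → j ≤ n → term i j ≡ (n C i) * (n C i) * (((n ∸ i) C (n ∸ j)) * (i C (n ∸ j)))
    complement-both j j≤n = begin
      ((n C j) * (j C i)) * ((n C j) * (j C (n ∸ i)))
        ≡⟨ cong₂ _*_ (C-subset-complement n j i i≤n j≤n) (C-subset-complement n j (n ∸ i) (m∸n≤m n i) j≤n) ⟩
      ((n C i) * ((n ∸ i) C (n ∸ j))) * ((n C (n ∸ i)) * ((n ∸ (n ∸ i)) C (n ∸ j)))
        ≡⟨ cong₂ (λ x k → ((n C i) * ((n ∸ i) C (n ∸ j))) * (x * (k C (n ∸ j)))) (sym (nCk≡nC[n∸k] i≤n)) (m∸[m∸n]≡n i≤n) ⟩
      ((n C i) * ((n ∸ i) C (n ∸ j))) * ((n C i) * (i C (n ∸ j)))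
        ≡⟨ square-split (n C i) ((n ∸ i) C (n ∸ j)) (i C (n ∸ j)) ⟨
      (n C i) * (n C i) * (((n ∸ i) C (n ∸ j)) * (i C (n ∸ j))) ∎
    inner-sum : sumTo (suc n) (λ l → ((n ∸ i) C l) * (i C l)) ≡ n C i
    inner-sum = begin
      sumTo (suc n) (λ l → ((n ∸ i) C l) * (i C l))  ≡⟨ sum-cong (suc n) (λ l _ → *-comm ((n ∸ i) C l) (i C l)) ⟩
      sumTo (suc n) (λ l → (i C l) * ((n ∸ i) C l))  ≡⟨ vandermonde-squares i (n ∸ i) n i≤n ⟩
      (i + (n ∸ i)) C i                              ≡⟨ cong (_C i) (m+[n∸m]≡n i≤n) ⟩
      n C i                                          ∎

central-neighbour : ∀ j → suc j * ((j + j) C suc j) ≡ j * central j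
central-neighbour zero    = refl
central-neighbour (suc j) = begin
  suc (suc j) * (suc (j + suc j) C suc (suc j))  ≡⟨ C-absorb (j + suc j) (suc j) ⟩
  suc (j + suc j) * ((j + suc j) C suc j)        ≡⟨ cong (suc (j + suc j) *_) (C-sym+ j (suc j)) ⟨
  suc (j + suc j) * ((j + suc j) C j)            ≡⟨ C-absorb (j + suc j) j ⟨
  suc j * (suc (j + suc j) C suc j)              ∎

central-step : ∀ j → suc j * central (suc j) ≡ 2 * suc (j + j) * central j
central-step j = begin
  suc j * (suc (j + suc j) C suc j)         ≡⟨ C-absorb (j + suc j) j ⟩
  suc (j + suc j) * ((j + suc j) C j)       ≡⟨ cong (suc (j + suc j) *_) (C-sym+ j (suc j)) ⟩
  suc (j + suc j) * ((j + suc j) C suc j)   ≡⟨ cong (λ k → suc k * (k C suc j)) (+-suc j j) ⟩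
  suc (suc (j + j)) * (suc (j + j) C suc j) ≡⟨ double j (suc (j + j) C suc j) ⟩
  2 * (suc j * (suc (j + j) C suc j))       ≡⟨ cong (2 *_) (C-absorb (j + j) j) ⟩
  2 * (suc (j + j) * central j)             ≡⟨ *-assoc 2 (suc (j + j)) (central j) ⟨
  2 * suc (j + j) * central j               ∎
  where double : ∀ j x → suc (suc (j + j)) * x ≡ 2 * (suc j * x)
        double = solve-∀

catalan : ℕ → ℕ
catalan j = central j ∸ ((j + j) C suc j)

catalan-spec : ∀ j → suc j * catalan j ≡ central j
catalan-spec j = begin
  suc j * (central j ∸ ((j + j) C suc j))         ≡⟨ *-distribˡ-∸ (suc j) (central j) ((j + j) C suc j) ⟩
  suc j * central j ∸ suc j * ((j + j) C suc j)   ≡⟨ cong (suc j * central j ∸_) (central-neighbour j) ⟩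
  central j + j * central j ∸ j * central j       ≡⟨ m+n∸n≡m (central j) (j * central j) ⟩
  central j                                       ∎

-- Cat_j + C(2j,j+1) = c_j: the subtraction defining Cat_j does not truncate.
catalan-complement : ∀ j → catalan j + ((j + j) C suc j) ≡ central j
catalan-complement j = m∸n+n≡m (*-cancelˡ-≤ (suc j) neighbour-bound)
  where neighbour-bound : suc j * ((j + j) C suc j) ≤ suc j * central j
        neighbour-bound = subst (_≤ suc j * central j) (sym (central-neighbour j))
                                (m≤n+m (j * central j) (central j))

trinom-factorial : ∀ u e {k j} → k ≡ u + u + e → j ≡ u + e → trinom k j * (u ! * (u ! * e !)) ≡ k !
trinom-factorial u e refl refl = begin
  ((u + u + e) C (u + e)) * ((u + e) C (u + u + e ∸ (u + e))) * (u ! * (u ! * e !))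
    ≡⟨ cong (λ r → ((u + u + e) C (u + e)) * ((u + e) C r) * (u ! * (u ! * e !))) k-j≡u ⟩
  ((u + u + e) C (u + e)) * ((u + e) C u) * (u ! * (u ! * e !))
    ≡⟨ reassoc ((u + u + e) C (u + e)) ((u + e) C u) (u !) (e !) ⟩
  ((u + u + e) C (u + e)) * (((u + e) C u) * (u ! * e !) * u !)
    ≡⟨ cong (λ t → ((u + u + e) C (u + e)) * (t * u !)) (C-factorial+ u e) ⟩
  ((u + u + e) C (u + e)) * ((u + e) ! * u !)
    ≡⟨ subst (λ k → (k C (u + e)) * ((u + e) ! * u !) ≡ k !) (sym k≡j+u) (C-factorial+ (u + e) u) ⟩
  (u + u + e) ! ∎
  where
  k≡j+u : u + u + e ≡ u + e + u
  k≡j+u = index u e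
    where index : ∀ u e → u + u + e ≡ u + e + u
          index = solve-∀
  k-j≡u : u + u + e ∸ (u + e) ≡ u
  k-j≡u = trans (cong (_∸ (u + e)) k≡j+u) (m+n∸m≡n (u + e) u)
  reassoc : ∀ x y f g → x * y * (f * (f * g)) ≡ x * (y * (f * g) * f)
  reassoc = solve-∀

-- Neighbouring trinomial coefficients.  With m = 2u+e+1 and j = u+e+1, moving along the
-- row:  (u+1)² M(m+1,j) = (m+1)(e+1) M(m,j).  Both sides times u! u! (e+1)! are (e+1)(m+1)!.
trinom-step-row : ∀ u e →
  suc u * suc u * trinom (suc (suc (u + u + e))) (suc (u + e))
    ≡ suc (suc (u + u + e)) * suc e * trinom (suc (u + u + e)) (suc (u + e))
trinom-step-row u e = cancel-by (u ! * (u ! * suc e !)) {{D≢0}} lhs rhs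
  where
  D≢0 = m*n≢0 (u !) (u ! * suc e !) {{u !≢0}} {{u !* suc e !≢0}}
  m = suc (u + u + e)
  reassocˡ : ∀ A u fu e fe → suc u * suc u * A * (fu * (fu * (suc e * fe))) ≡ suc e * (A * (suc u * fu * (suc u * fu * fe)))
  reassocˡ = solve-∀
  reassocʳ : ∀ sm e B D → sm * suc e * B * D ≡ suc e * (sm * (B * D))
  reassocʳ = solve-∀
  index : ∀ u e → suc (suc (u + u + e)) ≡ suc u + suc u + e
  index = solve-∀
  index′ : ∀ u e → suc (u + u + e) ≡ u + u + suc e
  index′ = solve-∀
  index″ : ∀ u e → suc (u + e) ≡ u + suc e
  index″ = solve-∀
  lhs : suc u * suc u * trinom (suc m) (suc (u + e)) * (u ! * (u ! * suc e !)) ≡ suc e * suc m !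
  lhs = trans (reassocˡ (trinom (suc m) (suc (u + e))) u (u !) e (e !))
              (cong (suc e *_) (trinom-factorial (suc u) e (index u e) refl))
  rhs : suc m * suc e * trinom m (suc (u + e)) * (u ! * (u ! * suc e !)) ≡ suc e * suc m !
  rhs = trans (reassocʳ (suc m) e (trinom m (suc (u + e))) (u ! * (u ! * suc e !)))
              (cong (λ t → suc e * (suc m * t)) (trinom-factorial u (suc e) (index′ u e) (index″ u e)))

-- ... and along the diagonal:  (e+2) M(m+1,j+1) = (m+1) M(m,j).  Both sides times
-- u! u! (e+1)! are (m+1)!.
trinom-step-diagonal : ∀ u e →
  suc (suc e) * trinom (suc (suc (u + u + e))) (suc (suc (u + e)))
    ≡ suc (suc (u + u + e)) * trinom (suc (u + u + e)) (suc (u + e))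
trinom-step-diagonal u e = cancel-by (u ! * (u ! * suc e !)) {{D≢0}} lhs rhs
  where
  D≢0 = m*n≢0 (u !) (u ! * suc e !) {{u !≢0}} {{u !* suc e !≢0}}
  m = suc (u + u + e)
  reassoc : ∀ e A fu fe → suc (suc e) * A * (fu * (fu * fe)) ≡ A * (fu * (fu * (suc (suc e) * fe)))
  reassoc = solve-∀
  index : ∀ u e → suc (suc (u + u + e)) ≡ u + u + suc (suc e)
  index = solve-∀
  index′ : ∀ u e → suc (suc (u + e)) ≡ u + suc (suc e)
  index′ = solve-∀
  index″ : ∀ u e → suc (u + u + e) ≡ u + u + suc e
  index″ = solve-∀
  index‴ : ∀ u e → suc (u + e) ≡ u + suc e
  index‴ = solve-∀
  lhs : suc (suc e) * trinom (suc m) (suc (suc (u + e))) * (u ! * (u ! * suc e !)) ≡ suc m !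
  lhs = trans (reassoc e (trinom (suc m) (suc (suc (u + e)))) (u !) (suc e !))
              (trinom-factorial u (suc (suc e)) (index u e) (index′ u e))
  rhs : suc m * trinom m (suc (u + e)) * (u ! * (u ! * suc e !)) ≡ suc m !
  rhs = trans (*-assoc (suc m) (trinom m (suc (u + e))) (u ! * (u ! * suc e !)))
              (cong (suc m *_) (trinom-factorial u (suc e) (index″ u e) (index‴ u e)))

trinom-vanish-above : ∀ {k j} → k < j → trinom k j ≡ 0
trinom-vanish-above {k} {j} k<j = cong (_* (j C (k ∸ j))) (k>n⇒nCk≡0 k<j)

trinom-vanish-below : ∀ j t → trinom (j + j + suc t) j ≡ 0
trinom-vanish-below j t = begin
  ((j + j + suc t) C j) * (j C (j + j + suc t ∸ j))  ≡⟨ cong (λ r → ((j + j + suc t) C j) * (j C r)) k-j ⟩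
  ((j + j + suc t) C j) * (j C (j + suc t))          ≡⟨ cong (((j + j + suc t) C j) *_) (k>n⇒nCk≡0 (m<m+n j z<s)) ⟩
  ((j + j + suc t) C j) * 0                          ≡⟨ *-zeroʳ ((j + j + suc t) C j) ⟩
  0                                                  ∎
  where k-j : j + j + suc t ∸ j ≡ j + suc t
        k-j = trans (cong (_∸ j) (+-assoc j j (suc t))) (m+n∸m≡n j (j + suc t))

trinom-diagonal : ∀ k → trinom k k ≡ 1
trinom-diagonal k = cong₂ _*_ (nCn≡1 k) (cong (k C_) (n∸n≡0 k))

trinom-half : ∀ j → trinom (j + j) j ≡ central j
trinom-half j = trans (cong (central j *_) (trans (cong (j C_) (m+n∸m≡n j j)) (nCn≡1 j))) (*-identityʳ (central j))

trinom-half-next : ∀ j → trinom (suc (j + j)) (suc j) ≡ (suc (j + j) C suc j) * suc j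
trinom-half-next j = cong ((suc (j + j) C suc j) *_) (begin
  suc j C (j + j ∸ j)   ≡⟨ cong (suc j C_) (m+n∸m≡n j j) ⟩
  suc j C j             ≡⟨ nCk≡nC[n∸k] (n≤1+n j) ⟩
  suc j C (suc j ∸ j)   ≡⟨ cong (suc j C_) (m+n∸n≡m 1 j) ⟩
  suc j C 1             ≡⟨ nC1≡n (suc j) ⟩
  suc j                 ∎)

-- Summands of the recurrence  2(m+2)² T_{m+1} + 2(m+1)² T_m = (3m+5) f_{m+1}
-- and its certificate  G_m(j) = (2j-m-1) M(m+1,j) c_j  (the truncated subtraction
-- is harmless: M(m+1,j) = 0 whenever 2j < m+1).
lhsTerm : ℕ → ℕ → ℕ
lhsTerm m j = 2 * (suc (suc m) * suc (suc m)) * (trinom (suc m) j * catalan j)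
            + 2 * (suc m * suc m) * (trinom m j * catalan j)

rhsTerm : ℕ → ℕ → ℕ
rhsTerm m j = (3 * m + 5) * (trinom (suc m) j * central j)

certificate : ℕ → ℕ → ℕ
certificate m j = (j + j ∸ suc m) * (trinom (suc m) j * central j)

certificate-vanish : ∀ m j → trinom (suc m) j ≡ 0 → certificate m j ≡ 0
certificate-vanish m j A≡0 = trans (cong (λ a → (j + j ∸ suc m) * (a * central j)) A≡0) (*-zeroʳ (j + j ∸ suc m))

CertificateStep : ℕ → ℕ → Set
CertificateStep m j = lhsTerm m j + certificate m j ≡ rhsTerm m j + certificate m (suc j)

-- The generic case  m = 2u+e+1,  j = u+e+1  (so m-j = u and 2j-m = e+1).  Multiplied by
-- K = (u+1)²(j+1)(e+2), every term becomes a multiple of M(m,j) c_j by the neighbour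
-- relations of trinomial, Catalan and central binomial coefficients.
certificate-step-interior : ∀ u e → CertificateStep (suc (u + u + e)) (suc (u + e))
certificate-step-interior u e = *-cancelˡ-≡ _ _ K (begin
  K * (lhsTerm m j + certificate m j)
    ≡⟨ cong (λ k → K * (lhsTerm m j + k * (A * c))) coefficient ⟩
  K * (lhsTerm m j + e * (A * c))
    ≡⟨ expand-lhs u e A B Ct c ⟩
  2 * (suc (suc m) * suc (suc m)) * suc (suc e) * t₁ + 2 * (suc m * suc m) * (suc u * suc u) * suc (suc e) * t₂
    + e * suc (suc e) * suc j * t₃
    ≡⟨ cong₂ _+_ (cong₂ _+_ (cong (2 * (suc (suc m) * suc (suc m)) * suc (suc e) *_) t₁-value)
                            (cong (2 * (suc m * suc m) * (suc u * suc u) * suc (suc e) *_) t₂-value))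
                 (cong (e * suc (suc e) * suc j *_) t₃-value) ⟩
  2 * (suc (suc m) * suc (suc m)) * suc (suc e) * (suc m * suc e * B * c) + 2 * (suc m * suc m) * (suc u * suc u) * suc (suc e) * (B * c)
    + e * suc (suc e) * suc j * (suc m * suc e * B * c)
    ≡⟨ collect u e B c ⟩
  (3 * m + 5) * suc (suc e) * suc j * (suc m * suc e * B * c) + suc u * suc u * suc (suc e) * (suc m * B * (2 * suc (j + j) * c))
    ≡⟨ cong₂ _+_ (cong ((3 * m + 5) * suc (suc e) * suc j *_) t₃-value) (cong (suc u * suc u * suc (suc e) *_) t₄-value) ⟨
  (3 * m + 5) * suc (suc e) * suc j * t₃ + suc u * suc u * suc (suc e) * t₄
    ≡⟨ expand-rhs u e A A′ c c′ ⟩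
  K * (rhsTerm m j + suc (suc e) * (A′ * c′))
    ≡⟨ cong (λ k → K * (rhsTerm m j + k * (A′ * c′))) coefficient′ ⟨
  K * (rhsTerm m j + certificate m (suc j)) ∎)
  where
  m = suc (u + u + e)
  j = suc (u + e)
  K = suc u * suc u * suc j * suc (suc e)
  A = trinom (suc m) j
  B = trinom m j
  A′ = trinom (suc m) (suc j)
  Ct = catalan j
  c = central j
  c′ = central (suc j)
  t₁ = suc u * suc u * A * (suc j * Ct)
  t₂ = B * (suc j * Ct)
  t₃ = suc u * suc u * A * c
  t₄ = suc (suc e) * A′ * (suc j * c′)
  t₁-value : t₁ ≡ suc m * suc e * B * c
  t₁-value = cong₂ _*_ (trinom-step-row u e) (catalan-spec j)
  t₂-value : t₂ ≡ B * c
  t₂-value = cong (B *_) (catalan-spec j)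
  t₃-value : t₃ ≡ suc m * suc e * B * c
  t₃-value = cong (_* c) (trinom-step-row u e)
  t₄-value : t₄ ≡ suc m * B * (2 * suc (j + j) * c)
  t₄-value = cong₂ _*_ (trinom-step-diagonal u e) (central-step j)
  coefficient : j + j ∸ suc m ≡ e
  coefficient = trans (cong (_∸ suc m) (index u e)) (m+n∸m≡n (suc m) e)
    where index : ∀ u e → suc (u + e) + suc (u + e) ≡ suc (suc (u + u + e)) + e
          index = solve-∀
  coefficient′ : suc j + suc j ∸ suc m ≡ suc (suc e)
  coefficient′ = trans (cong (_∸ suc m) (index u e)) (m+n∸m≡n (suc m) (suc (suc e)))
    where index : ∀ u e → suc (suc (u + e)) + suc (suc (u + e)) ≡ suc (suc (u + u + e)) + suc (suc e)
          index = solve-∀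
  expand-lhs : ∀ u e A B Ct c → let m = suc (u + u + e) ; j = suc (u + e) in
    suc u * suc u * suc j * suc (suc e) *
      (2 * (suc (suc m) * suc (suc m)) * (A * Ct) + 2 * (suc m * suc m) * (B * Ct) + e * (A * c))
    ≡ 2 * (suc (suc m) * suc (suc m)) * suc (suc e) * (suc u * suc u * A * (suc j * Ct))
      + 2 * (suc m * suc m) * (suc u * suc u) * suc (suc e) * (B * (suc j * Ct))
      + e * suc (suc e) * suc j * (suc u * suc u * A * c)
  expand-lhs = solve-∀
  collect : ∀ u e B c → let m = suc (u + u + e) ; j = suc (u + e) in
    2 * (suc (suc m) * suc (suc m)) * suc (suc e) * (suc m * suc e * B * c)
      + 2 * (suc m * suc m) * (suc u * suc u) * suc (suc e) * (B * c)
      + e * suc (suc e) * suc j * (suc m * suc e * B * c)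
    ≡ (3 * m + 5) * suc (suc e) * suc j * (suc m * suc e * B * c)
      + suc u * suc u * suc (suc e) * (suc m * B * (2 * suc (j + j) * c))
  collect = solve-∀
  expand-rhs : ∀ u e A A′ c c′ → let m = suc (u + u + e) ; j = suc (u + e) in
    (3 * m + 5) * suc (suc e) * suc j * (suc u * suc u * A * c) + suc u * suc u * suc (suc e) * (suc (suc e) * A′ * (suc j * c′))
    ≡ suc u * suc u * suc j * suc (suc e) * ((3 * m + 5) * (A * c) + suc (suc e) * (A′ * c′))
  expand-rhs = solve-∀

certificate-step-vanishing : ∀ m j → trinom (suc m) j ≡ 0 → trinom m j ≡ 0 → certificate m (suc j) ≡ 0 →
  CertificateStep m j
certificate-step-vanishing m j A≡0 B≡0 G′≡0 = begin
  lhsTerm m j + certificate m j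
    ≡⟨ cong₂ (λ a b → 2 * (suc (suc m) * suc (suc m)) * (a * catalan j) + 2 * (suc m * suc m) * (b * catalan j)
                        + (j + j ∸ suc m) * (a * central j)) A≡0 B≡0 ⟩
  2 * (suc (suc m) * suc (suc m)) * 0 + 2 * (suc m * suc m) * 0 + (j + j ∸ suc m) * 0
    ≡⟨ zeros (2 * (suc (suc m) * suc (suc m))) (2 * (suc m * suc m)) (j + j ∸ suc m) (3 * m + 5) ⟩
  (3 * m + 5) * 0 + 0
    ≡⟨ cong₂ (λ a g → (3 * m + 5) * (a * central j) + g) A≡0 G′≡0 ⟨
  rhsTerm m j + certificate m (suc j) ∎
  where zeros : ∀ a b k l → a * 0 + b * 0 + k * 0 ≡ l * 0 + 0
        zeros = solve-∀

-- j = m+1: only M(m+1,m+1) = 1 survives, and the identity reduces to c_j = (j+1) Cat_j.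
certificate-step-diagonal : ∀ m → CertificateStep m (suc m)
certificate-step-diagonal m = begin
  lhsTerm m j + certificate m j
    ≡⟨ cong₂ (λ a b → 2 * (suc (suc m) * suc (suc m)) * (a * Ct) + 2 * (suc m * suc m) * (b * Ct)
                        + (j + j ∸ suc m) * (a * central j)) (trinom-diagonal j) (trinom-vanish-above (n<1+n m)) ⟩
  2 * (suc (suc m) * suc (suc m)) * (1 * Ct) + 2 * (suc m * suc m) * 0 + (j + j ∸ suc m) * (1 * central j)
    ≡⟨ cong₂ (λ k x → 2 * (suc (suc m) * suc (suc m)) * (1 * Ct) + 2 * (suc m * suc m) * 0 + k * (1 * x))
             (m+n∸n≡m j j) (sym (catalan-spec j)) ⟩
  2 * (suc (suc m) * suc (suc m)) * (1 * Ct) + 2 * (suc m * suc m) * 0 + suc m * (1 * (suc j * Ct))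
    ≡⟨ algebra m Ct (suc j + suc j ∸ suc m) ⟩
  (3 * m + 5) * (1 * (suc j * Ct)) + (suc j + suc j ∸ suc m) * 0
    ≡⟨ cong (λ x → (3 * m + 5) * (1 * x) + (suc j + suc j ∸ suc m) * 0) (catalan-spec j) ⟩
  (3 * m + 5) * (1 * central j) + (suc j + suc j ∸ suc m) * 0
    ≡⟨ cong₂ (λ a a′ → (3 * m + 5) * (a * central j) + (suc j + suc j ∸ suc m) * (a′ * central (suc j)))
             (trinom-diagonal j) (trinom-vanish-above (n<1+n j)) ⟨
  rhsTerm m j + certificate m (suc j) ∎
  where
  j = suc m
  Ct = catalan j
  algebra : ∀ m Ct k → 2 * (suc (suc m) * suc (suc m)) * (1 * Ct) + 2 * (suc m * suc m) * 0 + suc m * (1 * (suc (suc m) * Ct))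
                     ≡ (3 * m + 5) * (1 * (suc (suc m) * Ct)) + k * 0
  algebra = solve-∀

-- m = 2j: M(m+1,j) = 0 and M(m,j) = c_j; after multiplying by j+1 the identity is
-- 2(2j+1)² c_j² = ((j+1) C(2j+1,j+1)) ((j+1) c_{j+1}).
certificate-step-half : ∀ j → CertificateStep (j + j) j
certificate-step-half j = *-cancelˡ-≡ _ _ (suc j) (begin
  suc j * (lhsTerm m j + certificate m j)
    ≡⟨ cong₂ (λ a b → suc j * (2 * (suc (suc m) * suc (suc m)) * (a * Ct) + 2 * (suc m * suc m) * (b * Ct)
                                + (j + j ∸ suc m) * (a * c))) A≡0 (trinom-half j) ⟩
  suc j * (2 * (suc (suc m) * suc (suc m)) * 0 + 2 * (suc m * suc m) * (c * Ct) + (j + j ∸ suc m) * 0)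
    ≡⟨ expand-lhs j (suc m) c Ct (j + j ∸ suc m) ⟩
  2 * (suc m * suc m) * c * (suc j * Ct)
    ≡⟨ cong (2 * (suc m * suc m) * c *_) (catalan-spec j) ⟩
  2 * (suc m * suc m) * c * c
    ≡⟨ regroup (suc m) c ⟩
  (suc m * c) * (2 * suc m * c)
    ≡⟨ cong₂ _*_ (C-absorb (j + j) j) (central-step j) ⟨
  (suc j * X) * (suc j * central (suc j))
    ≡⟨ expand-rhs j m X (central (suc j)) ⟨
  suc j * ((3 * m + 5) * 0 + 1 * ((X * suc j) * central (suc j)))
    ≡⟨ cong₂ (λ a k → suc j * ((3 * m + 5) * (a * c) + k * ((X * suc j) * central (suc j)))) A≡0 coefficient′ ⟨
  suc j * ((3 * m + 5) * (trinom (suc m) j * c) + (suc j + suc j ∸ suc m) * ((X * suc j) * central (suc j)))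
    ≡⟨ cong (λ a′ → suc j * (rhsTerm m j + (suc j + suc j ∸ suc m) * (a′ * central (suc j)))) (trinom-half-next j) ⟨
  suc j * (rhsTerm m j + certificate m (suc j)) ∎)
  where
  m = j + j
  Ct = catalan j
  c = central j
  X = suc (j + j) C suc j
  A≡0 : trinom (suc m) j ≡ 0
  A≡0 = trans (cong (λ k → trinom k j) (+-comm 1 m)) (trinom-vanish-below j 0)
  coefficient′ : suc j + suc j ∸ suc m ≡ 1
  coefficient′ = trans (cong (_∸ m) (+-suc j j)) (m+n∸n≡m 1 m)
  expand-lhs : ∀ j sm c Ct k → suc j * (2 * (suc sm * suc sm) * 0 + 2 * (sm * sm) * (c * Ct) + k * 0)
                              ≡ 2 * (sm * sm) * c * (suc j * Ct)
  expand-lhs = solve-∀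
  regroup : ∀ sm c → 2 * (sm * sm) * c * c ≡ (sm * c) * (2 * sm * c)
  regroup = solve-∀
  expand-rhs : ∀ j m X c′ → suc j * ((3 * m + 5) * 0 + 1 * ((X * suc j) * c′)) ≡ (suc j * X) * (suc j * c′)
  expand-rhs = solve-∀

data Position (m j : ℕ) : Set where
  beyond   : ∀ t → j ≡ suc (suc (m + t)) → Position m j
  diagonal : j ≡ suc m → Position m j
  interior : ∀ u e → m ≡ suc (u + u + e) → j ≡ suc (u + e) → Position m j
  half     : m ≡ j + j → Position m j
  below    : ∀ t → m ≡ j + j + suc t → Position m j

position : ∀ m j → Position m j
position m j with compare j (suc m)
... | greater _ t = beyond t refl
... | equal _     = diagonal refl
... | less _ k    = inside j k (compare k j)
  where
  inside : ∀ j k → Ordering k j → Position (j + k) j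
  inside _ k (less _ e)    = interior k e (index k e) refl
    where index : ∀ k e → suc (k + e) + k ≡ suc (k + k + e)
          index = solve-∀
  inside j _ (equal _)     = half refl
  inside j _ (greater _ t) = below t (index j t)
    where index : ∀ j t → j + suc (j + t) ≡ j + j + suc t
          index = solve-∀

certificate-step : ∀ m j → CertificateStep m j
certificate-step m j with position m j
... | beyond t refl       = certificate-step-vanishing m j (trinom-vanish-above m+1<j)
                              (trinom-vanish-above (<-trans (n<1+n m) m+1<j))
                              (certificate-vanish m (suc j) (trinom-vanish-above (m<n⇒m<1+n m+1<j)))
  where m+1<j : suc m < j
        m+1<j = s≤s (s≤s (m≤m+n m t))
... | diagonal refl       = certificate-step-diagonal m
... | interior u e refl refl = certificate-step-interior u e
... | half refl           = certificate-step-half j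
... | below t refl        = certificate-step-vanishing m j
                              (trans (cong (λ k → trinom k j) (sym (+-suc (j + j) (suc t)))) (trinom-vanish-below j (suc t)))
                              (trinom-vanish-below j t)
                              (cong (_* (trinom (suc m) (suc j) * central (suc j))) (m≤n⇒m∸n≡0 j+1≤m))
  where j+1≤m : suc j + suc j ≤ suc (j + j + suc t)
        j+1≤m = s≤s (subst (_≤ j + j + suc t) (sym (+-suc j j)) (m<m+n (j + j) z<s))

catalanSum : ℕ → ℕ
catalanSum m = sumTo (suc m) (λ j → trinom m j * catalan j)

-- The recurrence  2(m+2)² T_{m+1} + 2(m+1)² T_m = (3m+5) f_{m+1}:  summing the termwise
-- identity over j ≤ m+2 telescopes, the boundary values of the certificate being 0.
recurrence : ∀ m → 2 * (suc (suc m) * suc (suc m)) * catalanSum (suc m) + 2 * (suc m * suc m) * catalanSum m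
                   ≡ (3 * m + 5) * franel (suc m)
recurrence m = begin
  2 * X * catalanSum (suc m) + 2 * Y * catalanSum m
    ≡⟨ cong₂ (λ s t → 2 * X * s + 2 * Y * t)
             (sum-extend (suc (suc m)) 1 _ (λ j m+1<j → cong (_* catalan j) (trinom-vanish-above m+1<j)))
             (sum-extend (suc m) 2 _ (λ j m<j → cong (_* catalan j) (trinom-vanish-above m<j))) ⟨
  2 * X * sumTo N (λ j → trinom (suc m) j * catalan j) + 2 * Y * sumTo N (λ j → trinom m j * catalan j)
    ≡⟨ cong₂ _+_ (sum-*ˡ N (2 * X) _) (sum-*ˡ N (2 * Y) _) ⟨
  sumTo N (λ j → 2 * X * (trinom (suc m) j * catalan j)) + sumTo N (λ j → 2 * Y * (trinom m j * catalan j))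
    ≡⟨ sum-+ N (λ j → 2 * X * (trinom (suc m) j * catalan j)) (λ j → 2 * Y * (trinom m j * catalan j)) ⟨
  sumTo N (lhsTerm m)
    ≡⟨ +-identityʳ _ ⟨
  sumTo N (lhsTerm m) + 0
    ≡⟨ telescope N (lhsTerm m) (rhsTerm m) (certificate m) (certificate-step m) ⟩
  sumTo N (rhsTerm m) + certificate m N
    ≡⟨ cong (λ x → sumTo N (rhsTerm m) + x) (certificate-vanish m N (trinom-vanish-above (s≤s (n≤1+n (suc m))))) ⟩
  sumTo N (rhsTerm m) + 0
    ≡⟨ +-identityʳ _ ⟩
  sumTo N (rhsTerm m)
    ≡⟨ sum-*ˡ N (3 * m + 5) _ ⟩
  (3 * m + 5) * sumTo N (λ j → trinom (suc m) j * central j)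
    ≡⟨ cong ((3 * m + 5) *_) (sum-extend (suc (suc m)) 1 _ (λ j m+1<j → cong (_* central j) (trinom-vanish-above m+1<j))) ⟩
  (3 * m + 5) * sumTo (suc (suc m)) (λ j → trinom (suc m) j * central j)
    ≡⟨ cong ((3 * m + 5) *_) (strehl (suc m)) ⟨
  (3 * m + 5) * franel (suc m) ∎
  where
  X = suc (suc m) * suc (suc m)
  Y = suc m * suc m
  N = suc (suc (suc m))

alternating-step : ∀ (s P Q c F : ℤ) → c ℤ.* F ≡ Q ℤ.+ P → s ℤ.* P ℤ.+ c ℤ.* (- s) ℤ.* F ≡ (- s) ℤ.* Q
alternating-step s P Q c F cF≡Q+P = begin
  s ℤ.* P ℤ.+ c ℤ.* (- s) ℤ.* F       ≡⟨ regroup s P c F ⟩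
  s ℤ.* P ℤ.+ (- s) ℤ.* (c ℤ.* F)     ≡⟨ cong (λ x → s ℤ.* P ℤ.+ (- s) ℤ.* x) cF≡Q+P ⟩
  s ℤ.* P ℤ.+ (- s) ℤ.* (Q ℤ.+ P)     ≡⟨ cancel s P Q ⟩
  (- s) ℤ.* Q                         ∎
  where
  regroup : ∀ s P c F → s ℤ.* P ℤ.+ c ℤ.* (- s) ℤ.* F ≡ s ℤ.* P ℤ.+ (- s) ℤ.* (c ℤ.* F)
  regroup = ℤ-Solver.solve-∀
  cancel : ∀ s P Q → s ℤ.* P ℤ.+ (- s) ℤ.* (Q ℤ.+ P) ≡ (- s) ℤ.* Q
  cancel = ℤ-Solver.solve-∀

franelSum-closed : ∀ m → franelSum (suc m) ≡ sign m ℤ.* + (2 * suc m * suc m * catalanSum m)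
franelSum-closed zero    = refl
franelSum-closed (suc m) = begin
  franelSum (suc m) ℤ.+ + (3 * suc m + 2) ℤ.* sign (suc m) ℤ.* + franel (suc m)
    ≡⟨ cong (ℤ._+ + (3 * suc m + 2) ℤ.* sign (suc m) ℤ.* + franel (suc m)) (franelSum-closed m) ⟩
  sign m ℤ.* + P ℤ.+ + (3 * suc m + 2) ℤ.* (- sign m) ℤ.* + franel (suc m)
    ≡⟨ alternating-step (sign m) (+ P) (+ Q) (+ (3 * suc m + 2)) (+ franel (suc m)) integral ⟩
  (- sign m) ℤ.* + Q ∎
  where
  P = 2 * suc m * suc m * catalanSum m
  Q = 2 * suc (suc m) * suc (suc m) * catalanSum (suc m)
  natural : (3 * suc m + 2) * franel (suc m) ≡ Q + P
  natural = begin
    (3 * suc m + 2) * franel (suc m)   ≡⟨ cong (_* franel (suc m)) (coefficient m) ⟩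
    (3 * m + 5) * franel (suc m)       ≡⟨ recurrence m ⟨
    2 * (suc (suc m) * suc (suc m)) * catalanSum (suc m) + 2 * (suc m * suc m) * catalanSum m
                                       ≡⟨ cong₂ _+_ (reassoc (suc (suc m)) (catalanSum (suc m))) (reassoc (suc m) (catalanSum m)) ⟩
    Q + P                              ∎
    where coefficient : ∀ m → 3 * suc m + 2 ≡ 3 * m + 5
          coefficient = solve-∀
          reassoc : ∀ n T → 2 * (n * n) * T ≡ 2 * n * n * T
          reassoc = solve-∀
  integral : + (3 * suc m + 2) ℤ.* + franel (suc m) ≡ + Q ℤ.+ + P
  integral = trans (sym (ℤ.pos-* (3 * suc m + 2) (franel (suc m)))) (trans (cong +_ natural) (ℤ.pos-+ Q P))

infix 4 _≡₂_
_≡₂_ : ℕ → ℕ → Set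
x ≡₂ y = x % 2 ≡ y % 2

≡₂-+ : ∀ a b c d → a ≡₂ b → c ≡₂ d → a + c ≡₂ b + d
≡₂-+ a b c d a≡b c≡d = begin
  (a + c) % 2                ≡⟨ %-distribˡ-+ a c 2 ⟩
  (a % 2 + c % 2) % 2        ≡⟨ cong₂ (λ x y → (x + y) % 2) a≡b c≡d ⟩
  (b % 2 + d % 2) % 2        ≡⟨ %-distribˡ-+ b d 2 ⟨
  (b + d) % 2                ∎

double-≡₂ : ∀ x → x + x ≡₂ 0
double-≡₂ x = trans (cong (_% 2) (x+x≡x*2 x)) (m*n%n≡0 x 2)
  where x+x≡x*2 : ∀ x → x + x ≡ x * 2
        x+x≡x*2 = solve-∀

+double-≡₂ : ∀ x y → x + (y + y) ≡₂ x
+double-≡₂ x y = trans (≡₂-+ x x (y + y) 0 refl (double-≡₂ y)) (cong (_% 2) (+-identityʳ x))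

*-even : ∀ x y → y ≡₂ 0 → x * y ≡₂ 0
*-even x y y≡0 = begin
  (x * y) % 2              ≡⟨ %-distribˡ-* x y 2 ⟩
  (x % 2 * (y % 2)) % 2    ≡⟨ cong (λ r → (x % 2 * r) % 2) y≡0 ⟩
  (x % 2 * 0) % 2          ≡⟨ cong (_% 2) (*-zeroʳ (x % 2)) ⟩
  0                        ∎

sum-even : ∀ n (f : ℕ → ℕ) → (∀ j → j < n → f j ≡₂ 0) → sumTo n f ≡₂ 0
sum-even zero    f even = refl
sum-even (suc n) f even = ≡₂-+ (sumTo n f) 0 (f n) 0 (sum-even n f (λ j j<n → even j (m<n⇒m<1+n j<n))) (even n (n<1+n n))

-- Two steps of Pascal's rule:  C(n+2,k+2) ≡ C(n,k) + C(n,k+2)  (mod 2),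
-- the middle contribution 2 C(n,k+1) being even.
pascal²-≡₂ : ∀ n k → suc (suc n) C suc (suc k) ≡₂ (n C k) + (n C suc (suc k))
pascal²-≡₂ n k = begin
  (suc (suc n) C suc (suc k)) % 2
    ≡⟨ cong (_% 2) (sym (nCk+nC[k+1]≡[n+1]C[k+1] (suc n) (suc k))) ⟩
  ((suc n C suc k) + (suc n C suc (suc k))) % 2
    ≡⟨ cong₂ (λ x y → (x + y) % 2) (sym (nCk+nC[k+1]≡[n+1]C[k+1] n k)) (sym (nCk+nC[k+1]≡[n+1]C[k+1] n (suc k))) ⟩
  ((n C k) + (n C suc k) + ((n C suc k) + (n C suc (suc k)))) % 2
    ≡⟨ cong (_% 2) (regroup (n C k) (n C suc k) (n C suc (suc k))) ⟩
  ((n C k) + (n C suc (suc k)) + ((n C suc k) + (n C suc k))) % 2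
    ≡⟨ +double-≡₂ ((n C k) + (n C suc (suc k))) (n C suc k) ⟩
  ((n C k) + (n C suc (suc k))) % 2 ∎
  where regroup : ∀ a b c → a + b + (b + c) ≡ a + c + (b + b)
        regroup = solve-∀

C-double-odd : ∀ a b → (a + a) C suc (b + b) ≡₂ 0
C-double-odd zero    b       = refl
C-double-odd (suc a) zero    = trans (cong (_% 2) (nC1≡n (suc a + suc a))) (double-≡₂ (suc a))
C-double-odd (suc a) (suc b) = begin
  ((suc a + suc a) C suc (suc b + suc b)) % 2
    ≡⟨ cong₂ (λ x y → (suc x C suc (suc y)) % 2) (+-suc a a) (+-suc b b) ⟩
  (suc (suc (a + a)) C suc (suc (suc (b + b)))) % 2
    ≡⟨ pascal²-≡₂ (a + a) (suc (b + b)) ⟩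
  (((a + a) C suc (b + b)) + ((a + a) C suc (suc (suc (b + b))))) % 2
    ≡⟨ ≡₂-+ ((a + a) C suc (b + b)) 0 ((a + a) C suc (suc (suc (b + b)))) 0 (C-double-odd a b) next ⟩
  0 ∎
  where next : (a + a) C suc (suc (suc (b + b))) ≡₂ 0
        next = trans (cong (λ y → ((a + a) C suc y) % 2) (sym (+-suc (suc b) b))) (C-double-odd a (suc b))

C-double : ∀ a b → (a + a) C (b + b) ≡₂ a C b
C-double zero    zero    = refl
C-double zero    (suc b) = refl
C-double (suc a) zero    = refl
C-double (suc a) (suc b) = begin
  ((suc a + suc a) C (suc b + suc b)) % 2
    ≡⟨ cong₂ (λ x y → (suc x C suc y) % 2) (+-suc a a) (+-suc b b) ⟩
  (suc (suc (a + a)) C suc (suc (b + b))) % 2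
    ≡⟨ pascal²-≡₂ (a + a) (b + b) ⟩
  (((a + a) C (b + b)) + ((a + a) C suc (suc (b + b)))) % 2
    ≡⟨ ≡₂-+ ((a + a) C (b + b)) (a C b) ((a + a) C suc (suc (b + b))) (a C suc b) (C-double a b) next ⟩
  ((a C b) + (a C suc b)) % 2
    ≡⟨ cong (_% 2) (nCk+nC[k+1]≡[n+1]C[k+1] a b) ⟩
  (suc a C suc b) % 2 ∎
  where next : (a + a) C suc (suc (b + b)) ≡₂ a C suc b
        next = trans (cong (λ y → ((a + a) C y) % 2) (sym (+-suc (suc b) b))) (C-double a (suc b))

-- Central binomial coefficients c_{k+1} = 2 C(2k+1,k+1) are even.
central-even : ∀ k → central (suc k) ≡₂ 0
central-even k = begin
  (suc (k + suc k) C suc k) % 2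
    ≡⟨ cong (_% 2) (nCk+nC[k+1]≡[n+1]C[k+1] (k + suc k) k) ⟨
  (((k + suc k) C k) + ((k + suc k) C suc k)) % 2
    ≡⟨ cong (λ x → (x + ((k + suc k) C suc k)) % 2) (C-sym+ k (suc k)) ⟩
  (((k + suc k) C suc k) + ((k + suc k) C suc k)) % 2
    ≡⟨ double-≡₂ ((k + suc k) C suc k) ⟩
  0 ∎

-- M(m,j) is even for j < m: writing m = j + i with i ≥ 1,
--   M(j+i,j) = C(j+i,i) C(j,i) = C(j+i,2i) c_i   by C-subset.
trinom-even : ∀ {m j} → j < m → trinom m j ≡₂ 0
trinom-even {m} {j} j<m with m≤n⇒∃[o]m+o≡n j<m
... | i , refl = trans (cong (_% 2) (begin
  ((suc j + i) C j) * (j C (suc j + i ∸ j))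
    ≡⟨ cong (λ n → (n C j) * (j C (n ∸ j))) (sym (+-suc j i)) ⟩
  ((j + suc i) C j) * (j C (j + suc i ∸ j))
    ≡⟨ cong₂ (λ x r → x * (j C r)) (C-sym+ j (suc i)) (m+n∸m≡n j (suc i)) ⟩
  ((j + suc i) C suc i) * (j C suc i)
    ≡⟨ cong₂ (λ n r → ((j + suc i) C suc i) * (n C r)) (m+n∸n≡m j (suc i)) (m+n∸n≡m (suc i) (suc i)) ⟨
  ((j + suc i) C suc i) * ((j + suc i ∸ suc i) C (suc i + suc i ∸ suc i))
    ≡⟨ C-subset (j + suc i) (suc i + suc i) (suc i) (m≤n+m (suc i) (suc i)) ⟨
  ((j + suc i) C (suc i + suc i)) * central (suc i) ∎))
  (*-even ((j + suc i) C (suc i + suc i)) (central (suc i)) (central-even i))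

middle : ℕ → ℕ
middle m = suc (m + m) C suc m

-- Cat_m ≡ C(2m+1,m+1)  (mod 2): both differ from C(2m,m) by C(2m,m+1).
catalan-≡₂-middle : ∀ m → catalan m ≡₂ middle m
catalan-≡₂-middle m = sym (begin
  middle m % 2
    ≡⟨ cong (_% 2) (nCk+nC[k+1]≡[n+1]C[k+1] (m + m) m) ⟨
  (central m + D) % 2
    ≡⟨ cong (λ c → (c + D) % 2) (catalan-complement m) ⟨
  (catalan m + D + D) % 2
    ≡⟨ cong (_% 2) (+-assoc (catalan m) D D) ⟩
  (catalan m + (D + D)) % 2
    ≡⟨ +double-≡₂ (catalan m) D ⟩
  catalan m % 2 ∎)
  where D = (m + m) C suc m

-- T_m ≡ Cat_m ≡ C(2m+1,m+1)  (mod 2): only the term j = m of T_m is odd-weighted.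
catalanSum-≡₂-middle : ∀ m → catalanSum m ≡₂ middle m
catalanSum-≡₂-middle m = trans
  (≡₂-+ (sumTo m (λ j → trinom m j * catalan j)) 0 (trinom m m * catalan m) (catalan m)
        (sum-even m (λ j → trinom m j * catalan j) even-term) last-term)
  (catalan-≡₂-middle m)
  where
  even-term : ∀ j → j < m → trinom m j * catalan j ≡₂ 0
  even-term j j<m = trans (cong (_% 2) (*-comm (trinom m j) (catalan j)))
                          (*-even (catalan j) (trinom m j) (trinom-even j<m))
  last-term : trinom m m * catalan m ≡₂ catalan m
  last-term = cong (_% 2) (trans (cong (_* catalan m) (trinom-diagonal m)) (*-identityˡ (catalan m)))

-- For even n = m+1 = 2(k+1):  C(2m+1,m+1) ≡ C(2k+1,k+1)  (mod 2), by Lucas' theorem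
-- after one step of Pascal's rule.
middle-halve : ∀ k → middle (suc (k + k)) ≡₂ middle k
middle-halve k = begin
  middle a % 2
    ≡⟨ cong (_% 2) (nCk+nC[k+1]≡[n+1]C[k+1] (a + a) a) ⟨
  (((a + a) C suc (k + k)) + ((a + a) C suc a)) % 2
    ≡⟨ cong (λ y → (((a + a) C suc (k + k)) + ((a + a) C y)) % 2) (cong suc (+-suc k k)) ⟨
  (((a + a) C suc (k + k)) + ((a + a) C (suc k + suc k))) % 2
    ≡⟨ ≡₂-+ ((a + a) C suc (k + k)) 0 ((a + a) C (suc k + suc k)) (middle k) (C-double-odd a k) (C-double a (suc k)) ⟩
  middle k % 2 ∎
  where a = suc (k + k)

-- For odd n = m+1 = 2k+3:  C(2m+1,m+1) is even, being ≡ c_{k+1} (mod 2).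
middle-even-for-odd : ∀ k → middle (suc (suc (k + k))) ≡₂ 0
middle-even-for-odd k = begin
  middle a % 2
    ≡⟨ cong (_% 2) (nCk+nC[k+1]≡[n+1]C[k+1] (a + a) a) ⟨
  (((a + a) C a) + ((a + a) C suc a)) % 2
    ≡⟨ cong (λ x → (((x + x) C x) + ((x + x) C suc x)) % 2) a≡b+b ⟩
  ((((b + b) + (b + b)) C (b + b)) + (((b + b) + (b + b)) C suc (b + b))) % 2
    ≡⟨ ≡₂-+ (((b + b) + (b + b)) C (b + b)) 0 (((b + b) + (b + b)) C suc (b + b)) 0
            (trans (C-double (b + b) b) (central-even k)) (C-double-odd (b + b) b) ⟩
  0 ∎
  where
  a = suc (suc (k + k))
  b = suc k
  a≡b+b : a ≡ b + b
  a≡b+b = cong suc (sym (+-suc k k))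

data Shape : ℕ → Set where
  one    : Shape 0
  double : ∀ k → Shape (suc (k + k))
  odd    : ∀ k → Shape (suc (suc (k + k)))

shape : ∀ m → Shape m
shape zero = one
shape (suc m) with shape m
... | one      = double 0
... | double k = odd k
... | odd k    = subst Shape (cong (suc ∘ suc) (+-suc k k)) (double (suc k))

power-double : ∀ k → IsPowerOf2 (suc k) → IsPowerOf2 (suc (suc (k + k)))
power-double k (a , k+1≡2^a) = suc a , trans (index k) (cong (2 *_) k+1≡2^a)
  where index : ∀ k → suc (suc (k + k)) ≡ 2 * suc k
        index = solve-∀

power-half : ∀ k → IsPowerOf2 (suc (suc (k + k))) → IsPowerOf2 (suc k)
power-half k (zero  , ())
power-half k (suc a , 2k+2≡2^[a+1]) = a , *-cancelˡ-≡ (suc k) (2 ^ a) 2 (trans (sym (index k)) 2k+2≡2^[a+1])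
  where index : ∀ k → suc (suc (k + k)) ≡ 2 * suc k
        index = solve-∀

odd-not-power : ∀ k → ¬ IsPowerOf2 (suc (suc (suc (k + k))))
odd-not-power k (zero  , ())
odd-not-power k (suc a , n≡2^[a+1]) = 1≢0 (begin
  1                               ≡⟨ +double-≡₂ 1 (suc k) ⟨
  (1 + (suc k + suc k)) % 2       ≡⟨ cong (λ x → suc (suc x) % 2) (+-suc k k) ⟩
  suc (suc (suc (k + k))) % 2     ≡⟨ cong (_% 2) n≡2^[a+1] ⟩
  (2 * 2 ^ a) % 2                 ≡⟨ cong (_% 2) (*-comm 2 (2 ^ a)) ⟩
  (2 ^ a * 2) % 2                 ≡⟨ m*n%n≡0 (2 ^ a) 2 ⟩
  0                               ∎)
  where 1≢0 : ¬ 1 ≡ 0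
        1≢0 ()

MiddleParity : ℕ → Set
MiddleParity m = (IsPowerOf2 (suc m) × middle m ≡₂ 1) ⊎ (¬ IsPowerOf2 (suc m) × middle m ≡₂ 0)

middle-parity : ∀ m → MiddleParity m
middle-parity = <-rec MiddleParity step
  where
  step : ∀ m → (∀ {k} → k < m → MiddleParity k) → MiddleParity m
  step m rec with shape m
  ... | one      = inj₁ ((0 , refl) , refl)
  ... | odd k    = inj₂ (odd-not-power k , middle-even-for-odd k)
  ... | double k with rec {k} (s≤s (m≤n+m k k))
  ...   | inj₁ (power , middle-odd)      = inj₁ (power-double k power , trans (middle-halve k) middle-odd)
  ...   | inj₂ (not-power , middle-even) = inj₂ (not-power ∘ power-half k , trans (middle-halve k) middle-even)

sign-odd : ∀ m → ∃ λ w → sign m ≡ + 1 ℤ.+ w ℤ.* + 2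
sign-odd zero    = + 0 , refl
sign-odd (suc m) with sign-odd m
... | w , s≡1+2w = (- w) ℤ.- + 1 , trans (cong -_ s≡1+2w) (negate w)
  where negate : ∀ w → - (+ 1 ℤ.+ w ℤ.* + 2) ≡ + 1 ℤ.+ ((- w) ℤ.- + 1) ℤ.* + 2
        negate = ℤ-Solver.solve-∀

halve : ∀ t → + t ≡ + (t % 2) ℤ.+ + (t / 2) ℤ.* + 2
halve t = begin
  + t                                 ≡⟨ cong +_ (m≡m%n+[m/n]*n t 2) ⟩
  + (t % 2 + t / 2 * 2)               ≡⟨ ℤ.pos-+ (t % 2) (t / 2 * 2) ⟩
  + (t % 2) ℤ.+ + (t / 2 * 2)         ≡⟨ cong (λ x → + (t % 2) ℤ.+ x) (ℤ.pos-* (t / 2) 2) ⟩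
  + (t % 2) ℤ.+ + (t / 2) ℤ.* + 2     ∎

signed-even-multiple : ∀ m N t → t ≡₂ 0 → + (2 * N) ∣ sign m ℤ.* + (N * t)
signed-even-multiple m N t t-even = ∣⇒∣ᵤ (Signed.divides (sign m ℤ.* + (t / 2)) (begin
  sign m ℤ.* + (N * t)                                 ≡⟨ cong (λ x → sign m ℤ.* x) (ℤ.pos-* N t) ⟩
  sign m ℤ.* (+ N ℤ.* + t)                             ≡⟨ cong (λ x → sign m ℤ.* (+ N ℤ.* x)) t≡2q ⟩
  sign m ℤ.* (+ N ℤ.* (+ 0 ℤ.+ + (t / 2) ℤ.* + 2))     ≡⟨ regroup (sign m) (+ N) (+ (t / 2)) ⟩
  sign m ℤ.* + (t / 2) ℤ.* (+ 2 ℤ.* + N)               ≡⟨ cong (λ x → sign m ℤ.* + (t / 2) ℤ.* x) (ℤ.pos-* 2 N) ⟨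
  sign m ℤ.* + (t / 2) ℤ.* + (2 * N)                   ∎))
  where
  t≡2q : + t ≡ + 0 ℤ.+ + (t / 2) ℤ.* + 2
  t≡2q = trans (halve t) (cong (λ r → + r ℤ.+ + (t / 2) ℤ.* + 2) t-even)
  regroup : ∀ s N q → s ℤ.* (N ℤ.* (+ 0 ℤ.+ q ℤ.* + 2)) ≡ s ℤ.* q ℤ.* (+ 2 ℤ.* N)
  regroup = ℤ-Solver.solve-∀

signed-odd-multiple : ∀ m N t → t ≡₂ 1 → + (2 * N) ∣ sign m ℤ.* + (N * t) ℤ.- + N
signed-odd-multiple m N t t-odd with sign-odd m
... | w , s≡1+2w = ∣⇒∣ᵤ (Signed.divides (q ℤ.+ w ℤ.+ w ℤ.* q ℤ.* + 2) (begin
  sign m ℤ.* + (N * t) ℤ.- + N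
    ≡⟨ cong₂ (λ s x → s ℤ.* x ℤ.- + N) s≡1+2w (ℤ.pos-* N t) ⟩
  (+ 1 ℤ.+ w ℤ.* + 2) ℤ.* (+ N ℤ.* + t) ℤ.- + N
    ≡⟨ cong (λ x → (+ 1 ℤ.+ w ℤ.* + 2) ℤ.* (+ N ℤ.* x) ℤ.- + N) t≡1+2q ⟩
  (+ 1 ℤ.+ w ℤ.* + 2) ℤ.* (+ N ℤ.* (+ 1 ℤ.+ q ℤ.* + 2)) ℤ.- + N
    ≡⟨ expand w (+ N) q ⟩
  (q ℤ.+ w ℤ.+ w ℤ.* q ℤ.* + 2) ℤ.* (+ 2 ℤ.* + N)
    ≡⟨ cong (λ x → (q ℤ.+ w ℤ.+ w ℤ.* q ℤ.* + 2) ℤ.* x) (ℤ.pos-* 2 N) ⟨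
  (q ℤ.+ w ℤ.+ w ℤ.* q ℤ.* + 2) ℤ.* + (2 * N) ∎))
  where
  q = + (t / 2)
  t≡1+2q : + t ≡ + 1 ℤ.+ q ℤ.* + 2
  t≡1+2q = trans (halve t) (cong (λ r → + r ℤ.+ q ℤ.* + 2) t-odd)
  expand : ∀ w N q → (+ 1 ℤ.+ w ℤ.* + 2) ℤ.* (N ℤ.* (+ 1 ℤ.+ q ℤ.* + 2)) ℤ.- N
                     ≡ (q ℤ.+ w ℤ.+ w ℤ.* q ℤ.* + 2) ℤ.* (+ 2 ℤ.* N)
  expand = ℤ-Solver.solve-∀

twice-2n² : ∀ n → + (2 * (2 * n * n)) ≡ + (4 * n * n)
twice-2n² n = cong +_ (twice n)
  where twice : ∀ n → 2 * (2 * n * n) ≡ 4 * n * n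
        twice = solve-∀

franelSum-odd : ∀ m → catalanSum m ≡₂ 1 → + (4 * suc m * suc m) ∣ franelSum (suc m) ℤ.- + (2 * suc m * suc m)
franelSum-odd m T-odd = subst₂ _∣_ (twice-2n² (suc m)) (cong (ℤ._- + (2 * suc m * suc m)) (sym (franelSum-closed m)))
                               (signed-odd-multiple m (2 * suc m * suc m) (catalanSum m) T-odd)

franelSum-even : ∀ m → catalanSum m ≡₂ 0 → + (4 * suc m * suc m) ∣ franelSum (suc m)
franelSum-even m T-even = subst₂ _∣_ (twice-2n² (suc m)) (sym (franelSum-closed m))
                                 (signed-even-multiple m (2 * suc m * suc m) (catalanSum m) T-even)

theorem2p1 : (n : ℕ) → n > 0 →
    (IsPowerOf2 n → (+ (4 * n * n)) ∣ (franelSum n ℤ.- (+ (2 * n * n)))) ×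
    (¬ IsPowerOf2 n → (+ (4 * n * n)) ∣ franelSum n)
theorem2p1 (suc m) _ with middle-parity m
... | inj₁ (power , middle-odd) =
        (λ _ → franelSum-odd m (trans (catalanSum-≡₂-middle m) middle-odd))
      , (λ not-power → contradiction power not-power)
... | inj₂ (not-power , middle-even) =
        (λ power → contradiction power not-power)
      , (λ _ → franelSum-even m (trans (catalanSum-≡₂-middle m) middle-even))
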